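{- Let $G$ be a $K_4$-free graph on $n$ vertices and let $I$ be an independent set of $G$. If $Z$ is a triangle-free induced subgraph of $G - I$ of maximum order, then $$e(G) \le \min\left\{\frac{|Z|(|G| + |I|)}{2},\ |Z|\left(|G| - \frac34|Z|\right)\right\}.$$ Moreover, if $|I| > \frac{|G|}{3}$, then $e(G) \le \frac14(|G| - |I|)(|G| + 3|I|)$.
   Context: $|G|$ is the number of vertices and $e(G)$ the number of edges; $G - I$ denotes the subgraph induced by $V(G)\setminus I$. A graph is $K_4$-free if it contains no complete graph on 4 vertices as a subgraph. -}

module Defs where

open import Data.Nat using (ℕ; zero; suc; _+_; _<_; _<ᵇ_)
open import Data.Bool using (Bool; true; false; if_then_else_; _∧_)
open import Data.Fin using (Fin; toℕ)
open import Data.Fin.Subset using (Subset; _∈_; _∉_; _⊆_; ∁)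
open import Data.List using (List; map; allFin)
open import Data.Nat.ListAction using (sum)
open import Data.Empty using (⊥)
open import Relation.Binary.PropositionalEquality using (_≡_)
open import Relation.Nullary using (¬_)

record Graph (n : ℕ) : Set where
  field
    adj   : Fin n → Fin n → Bool
    sym   : ∀ i j → adj i j ≡ adj j i
    irrefl : ∀ i → adj i i ≡ false

open Graph public

Adj : ∀ {n} → Graph n → Fin n → Fin n → Set
Adj G i j = adj G i j ≡ true

edgeCount : ∀ {n} → Graph n → ℕ
edgeCount {n} G =
  sum (map (λ i → sum (map (λ j → if (toℕ i <ᵇ toℕ j) ∧ adj G i j then 1 else 0)
                           (allFin n)))
           (allFin n))

-- G contains no K4 (four pairwise adjacent vertices; adjacency forces distinctness).
K4Free : ∀ {n} → Graph n → Set
K4Free G = ∀ a b c d → Adj G a b → Adj G a c → Adj G a d →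
                       Adj G b c → Adj G b d → Adj G c d → ⊥

Independent : ∀ {n} → Graph n → Subset n → Set
Independent G I = ∀ i j → i ∈ I → j ∈ I → ¬ Adj G i j

TriangleFreeOn : ∀ {n} → Graph n → Subset n → Set
TriangleFreeOn G Z = ∀ a b c → a ∈ Z → b ∈ Z → c ∈ Z →
                     Adj G a b → Adj G a c → Adj G b c → ⊥

-- Since G is K₄-free, the neighbourhood of any vertex is triangle-free, so by the maximality
-- of Z every vertex has at most |Z| neighbours outside I, while all neighbours of a vertex
-- of I lie outside I. Summing these degree bounds gives 2e(G) ≤ |Z|(n + |I|). For the second
-- bound, G[Z] has at most |Z|²/4 edges by Mantel's theorem, and summing the degree bound over
-- V ∖ Z (where every edge at I lies, I being independent) shows that at most |Z|(n − |Z|)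
-- edges meet V ∖ Z. Finally z(4n − 3z) increases for z ≤ 2n/3, and |Z| ≤ n − |I| < 2n/3
-- once |I| > n/3.
module Submission where

open import Defs hiding (sym)
open import Data.Nat using (ℕ; zero; suc; _+_; _*_; _∸_; _≤_; _<_; z≤n; _<ᵇ_)
open import Data.Fin.Subset using (Subset; _⊆_; ∁; ∣_∣; _∈_; _∩_)
open import Data.Product using (_×_; _,_)

open import Data.Bool.Base using (Bool; true; false; _∧_; if_then_else_; T)
open import Data.Empty using (⊥; ⊥-elim)
open import Data.Fin.Base using (Fin; zero; suc; toℕ)
open import Data.Fin.Subset.Properties
  using (p∩q⊆p; p∩q⊆q; p⊆q⇒∣p∣≤∣q∣; ∣∁p∣≡n∸∣p∣; ∣p∣≤n; x∉p⇒x∈∁p; x∈∁p⇒x∉p)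
import Data.List.Base as List
open import Data.Nat.ListAction using (sum)
open import Data.Nat.Properties
open import Data.Nat.Tactic.RingSolver using (solve-∀)
open import Data.Sum using ([_,_]′)
open import Data.Vec.Base using ([]; _∷_; lookup; tabulate)
open import Data.Vec.Properties using ([]=⇒lookup; lookup⇒[]=; lookup∘tabulate; lookup-zipWith)
open import Function.Base using (_∘_; const)
open import Relation.Binary.PropositionalEquality
open import Algebra.Properties.CommutativeSemigroup *-commutativeSemigroup using (x∙yz≈y∙xz)
open import Algebra.Properties.Semiring.Sum +-*-semiring
  using (sum-syntax; sum-cong-≗; sum-replicate-zero; ∑-distrib-+; ∑-comm; *-distribˡ-sum; *-distribʳ-sum)

2*[m*n]≤m*m+n*n : ∀ m n → 2 * (m * n) ≤ m * m + n * n
2*[m*n]≤m*m+n*n m n = [ ordered , flipped ]′ (≤-total m n)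
  where
  ordered : ∀ {a b} → a ≤ b → 2 * (a * b) ≤ a * a + b * b
  ordered {a} a≤b with k , refl ← m≤n⇒∃[o]m+o≡n a≤b = begin
    2 * (a * (a + k))         ≤⟨ m≤m+n _ (k * k) ⟩
    2 * (a * (a + k)) + k * k ≡⟨ square a k ⟩
    a * a + (a + k) * (a + k) ∎
    where
    open ≤-Reasoning
    square : ∀ a k → 2 * (a * (a + k)) + k * k ≡ a * a + (a + k) * (a + k)
    square = solve-∀

  flipped : n ≤ m → 2 * (m * n) ≤ m * m + n * n
  flipped n≤m = subst₂ _≤_ (cong (2 *_) (*-comm n m)) (+-comm (n * n) (m * m)) (ordered n≤m)

c*a*a≤b*a⇒c*a≤b : ∀ c a b → c * a * a ≤ b * a → c * a ≤ b
c*a*a≤b*a⇒c*a≤b c zero    b _ = subst (_≤ b) (sym (*-zeroʳ c)) z≤n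
c*a*a≤b*a⇒c*a≤b c (suc a) b h = *-cancelʳ-≤ (c * suc a) b (suc a) h

quadratic-bound-mono : ∀ {x z m n} → z ≤ m → 3 * (z + m) ≤ 4 * n →
                       x + 3 * (z * z) ≤ 4 * (z * n) → x + 3 * (m * m) ≤ 4 * (m * n)
quadratic-bound-mono {x} {z} {n = n} z≤m 3[z+m]≤4n bound with k , refl ← m≤n⇒∃[o]m+o≡n z≤m = begin
  x + 3 * ((z + k) * (z + k))                   ≡⟨ expand x z k ⟩
  x + 3 * (z * z) + k * (3 * (z + (z + k)))     ≤⟨ +-mono-≤ bound (*-monoʳ-≤ k 3[z+m]≤4n) ⟩
  4 * (z * n) + k * (4 * n)                     ≡⟨ collect z k n ⟩
  4 * ((z + k) * n)                             ∎
  where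
  open ≤-Reasoning
  expand : ∀ x z k → x + 3 * ((z + k) * (z + k)) ≡ x + 3 * (z * z) + k * (3 * (z + (z + k)))
  expand = solve-∀
  collect : ∀ z k n → 4 * (z * n) + k * (4 * n) ≡ 4 * ((z + k) * n)
  collect = solve-∀

quadratic-bound-at : ∀ {x z m i n} → z ≤ m → m + i ≡ n → n < 3 * i →
                     x + 3 * (z * z) ≤ 4 * (z * n) → x ≤ m * (n + 3 * i)
quadratic-bound-at {x} {z} {m} {i} z≤m refl n<3i bound = +-cancelʳ-≤ (3 * (m * m)) x _ (begin
  x + 3 * (m * m)                   ≤⟨ quadratic-bound-mono {x} z≤m 3[z+m]≤4n bound ⟩
  4 * (m * (m + i))                 ≡⟨ split-square m i ⟩
  m * (m + i + 3 * i) + 3 * (m * m) ∎)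
  where
  open ≤-Reasoning
  split-square : ∀ m i → 4 * (m * (m + i)) ≡ m * (m + i + 3 * i) + 3 * (m * m)
  split-square = solve-∀
  3[z+m]≤4n : 3 * (z + m) ≤ 4 * (m + i)
  3[z+m]≤4n = +-cancelʳ-≤ (2 * i) _ _ (begin
    3 * (z + m) + 2 * i   ≤⟨ +-monoˡ-≤ (2 * i) (*-monoʳ-≤ 3 (+-monoˡ-≤ m z≤m)) ⟩
    3 * (m + m) + 2 * i   ≡⟨ regroup m i ⟩
    4 * m + 2 * (m + i)   ≤⟨ +-monoʳ-≤ (4 * m) (*-monoʳ-≤ 2 (<⇒≤ n<3i)) ⟩
    4 * m + 2 * (3 * i)   ≡⟨ regroup′ m i ⟩
    4 * (m + i) + 2 * i   ∎)
    where
    regroup : ∀ m i → 3 * (m + m) + 2 * i ≡ 4 * m + 2 * (m + i)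
    regroup = solve-∀
    regroup′ : ∀ m i → 4 * m + 2 * (3 * i) ≡ 4 * (m + i) + 2 * i
    regroup′ = solve-∀

∑-mono-≤ : ∀ {n} {f g : Fin n → ℕ} → (∀ i → f i ≤ g i) → ∑[ i < n ] f i ≤ ∑[ i < n ] g i
∑-mono-≤ {zero}  _   = z≤n
∑-mono-≤ {suc n} f≤g = +-mono-≤ (f≤g zero) (∑-mono-≤ (f≤g ∘ suc))

∑-const : ∀ n c → ∑[ i < n ] c ≡ n * c
∑-const zero    c = refl
∑-const (suc n) c = cong (c +_) (∑-const n c)

∑∑-distrib-+ : ∀ {n} (f g : Fin n → Fin n → ℕ) →
  ∑[ i < n ] ∑[ j < n ] (f i j + g i j) ≡ (∑[ i < n ] ∑[ j < n ] f i j) + (∑[ i < n ] ∑[ j < n ] g i j)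
∑∑-distrib-+ {n} f g = trans (sum-cong-≗ (λ i → ∑-distrib-+ (f i) (g i))) (∑-distrib-+ {n} _ _)

∑*∑≡∑∑ : ∀ {n} (f g : Fin n → ℕ) →
  (∑[ i < n ] f i) * (∑[ j < n ] g j) ≡ ∑[ i < n ] ∑[ j < n ] (f i * g j)
∑*∑≡∑∑ f g = trans (*-distribʳ-sum _ f) (sum-cong-≗ (λ i → *-distribˡ-sum (f i) g))

sum-map-tabulate : ∀ {A : Set} {n} (f : A → ℕ) (g : Fin n → A) →
  sum (List.map f (List.tabulate g)) ≡ ∑[ i < n ] f (g i)
sum-map-tabulate {n = zero}  f g = refl
sum-map-tabulate {n = suc n} f g = cong (f (g zero) +_) (sum-map-tabulate f (g ∘ suc))

∑-cauchy-schwarz : ∀ {n} (w d : Fin n → ℕ) →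
  (∑[ i < n ] (w i * d i)) * (∑[ i < n ] (w i * d i))
    ≤ (∑[ i < n ] w i) * (∑[ i < n ] (w i * d i * d i))
∑-cauchy-schwarz {n} w d = *-cancelˡ-≤ 2 (begin
  2 * (∑ wd * ∑ wd)                                ≡⟨ cong (2 *_) (∑*∑≡∑∑ wd wd) ⟩
  2 * (∑[ i < n ] ∑[ j < n ] (wd i * wd j))        ≡⟨ trans (*-distribˡ-sum {n} 2 _) (sum-cong-≗ {n} (λ i → *-distribˡ-sum {n} 2 _)) ⟩
  ∑[ i < n ] ∑[ j < n ] (2 * (wd i * wd j))        ≤⟨ ∑-mono-≤ (λ i → ∑-mono-≤ (λ j → pointwise i j)) ⟩
  ∑[ i < n ] ∑[ j < n ] (wdd i * w j + w i * wdd j) ≡⟨ ∑∑-distrib-+ {n} _ _ ⟩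
  (∑[ i < n ] ∑[ j < n ] (wdd i * w j)) + (∑[ i < n ] ∑[ j < n ] (w i * wdd j))
                                                   ≡⟨ sym (cong₂ _+_ (∑*∑≡∑∑ wdd w) (∑*∑≡∑∑ w wdd)) ⟩
  ∑ wdd * ∑ w + ∑ w * ∑ wdd                        ≡⟨ double (∑ w) (∑ wdd) ⟩
  2 * (∑ w * ∑ wdd)                                ∎)
  where
  open ≤-Reasoning
  ∑ : (Fin n → ℕ) → ℕ
  ∑ f = ∑[ i < n ] f i
  wd wdd : Fin n → ℕ
  wd i = w i * d i
  wdd i = w i * d i * d i
  double : ∀ a b → b * a + a * b ≡ 2 * (a * b)
  double = solve-∀
  pointwise : ∀ i j → 2 * (wd i * wd j) ≤ wdd i * w j + w i * wdd j
  pointwise i j = subst₂ _≤_ (lhs (w i) (w j) (d i) (d j)) (rhs (w i) (w j) (d i) (d j))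
                    (*-monoʳ-≤ (w i * w j) (2*[m*n]≤m*m+n*n (d i) (d j)))
    where
    lhs : ∀ a b x y → a * b * (2 * (x * y)) ≡ 2 * (a * x * (b * y))
    lhs = solve-∀
    rhs : ∀ a b x y → a * b * (x * x + y * y) ≡ a * x * x * b + a * (b * y * y)
    rhs = solve-∀

𝟙 : Bool → ℕ
𝟙 b = if b then 1 else 0

𝟙-∧ : ∀ b c → 𝟙 (b ∧ c) ≡ 𝟙 b * 𝟙 c
𝟙-∧ true  c = sym (+-identityʳ (𝟙 c))
𝟙-∧ false c = refl

χ : ∀ {n} → Subset n → Fin n → ℕ
χ p i = 𝟙 (lookup p i)

∣p∣≡∑χ : ∀ {n} (p : Subset n) → ∣ p ∣ ≡ ∑[ i < n ] χ p i
∣p∣≡∑χ []          = refl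
∣p∣≡∑χ (true  ∷ p) = cong suc (∣p∣≡∑χ p)
∣p∣≡∑χ (false ∷ p) = ∣p∣≡∑χ p

χ+χ∁≡1 : ∀ {n} (p : Subset n) i → χ p i + χ (∁ p) i ≡ 1
χ+χ∁≡1 (true  ∷ p) zero    = refl
χ+χ∁≡1 (false ∷ p) zero    = refl
χ+χ∁≡1 (_     ∷ p) (suc i) = χ+χ∁≡1 p i

∣p∣+∣∁p∣≡n : ∀ {n} (p : Subset n) → ∣ p ∣ + ∣ ∁ p ∣ ≡ n
∣p∣+∣∁p∣≡n p = trans (cong (∣ p ∣ +_) (∣∁p∣≡n∸∣p∣ p)) (m+[n∸m]≡n (∣p∣≤n p))

χ-∩ : ∀ {n} (p q : Subset n) i → χ (p ∩ q) i ≡ χ p i * χ q i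
χ-∩ p q i = trans (cong 𝟙 (lookup-zipWith _∧_ i p q)) (𝟙-∧ (lookup p i) (lookup q i))

χ-mono : ∀ {n} {p q : Subset n} → p ⊆ q → ∀ i → χ p i ≤ χ q i
χ-mono {p = p} {q} p⊆q i with lookup p i in eq
... | false = z≤n
... | true rewrite []=⇒lookup (p⊆q (lookup⇒[]= i p eq)) = ≤-refl

𝟙-∧-exclusive : ∀ b c x → (T b → T c → ⊥) → 𝟙 (b ∧ x) + 𝟙 (c ∧ x) ≤ 𝟙 x
𝟙-∧-exclusive true  true  x ¬bc = ⊥-elim (¬bc _ _)
𝟙-∧-exclusive true  false x _   = ≤-reflexive (+-identityʳ (𝟙 x))
𝟙-∧-exclusive false true  x _   = ≤-refl
𝟙-∧-exclusive false false x _   = z≤n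

𝟙*𝟙+𝟙*𝟙≤𝟙 : ∀ a b c → (a ≡ true → b ≡ true → c ≡ true → ⊥) → 𝟙 a * 𝟙 b + 𝟙 a * 𝟙 c ≤ 𝟙 a
𝟙*𝟙+𝟙*𝟙≤𝟙 false b     c     _    = z≤n
𝟙*𝟙+𝟙*𝟙≤𝟙 true  true  true  ¬abc = ⊥-elim (¬abc refl refl refl)
𝟙*𝟙+𝟙*𝟙≤𝟙 true  true  false _    = ≤-refl
𝟙*𝟙+𝟙*𝟙≤𝟙 true  false true  _    = ≤-refl
𝟙*𝟙+𝟙*𝟙≤𝟙 true  false false _    = z≤n

𝟙*𝟙*𝟙≡0 : ∀ a b c → (a ≡ true → b ≡ true → c ≡ true → ⊥) → 𝟙 a * (𝟙 b * 𝟙 c) ≡ 0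
𝟙*𝟙*𝟙≡0 false b     c     _    = refl
𝟙*𝟙*𝟙≡0 true  false c     _    = refl
𝟙*𝟙*𝟙≡0 true  true  false _    = refl
𝟙*𝟙*𝟙≡0 true  true  true  ¬abc = ⊥-elim (¬abc refl refl refl)

𝟙*𝟙*𝟙-*-mono-≤ : ∀ a b c {m k} → (a ≡ true → b ≡ true → c ≡ true → m ≤ k) →
                 𝟙 a * (𝟙 b * 𝟙 c) * m ≤ 𝟙 a * (𝟙 b * 𝟙 c) * k
𝟙*𝟙*𝟙-*-mono-≤ false b     c     _   = z≤n
𝟙*𝟙*𝟙-*-mono-≤ true  false c     _   = z≤n
𝟙*𝟙*𝟙-*-mono-≤ true  true  false _   = z≤n
𝟙*𝟙*𝟙-*-mono-≤ true  true  true  m≤k = +-monoˡ-≤ 0 (m≤k refl refl refl)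

module Counting {n} (G : Graph n) where

  -- For indicators, e (χ S) (χ T) counts the ordered adjacent pairs in S × T; allowing
  -- arbitrary weights makes e a symmetric bilinear form.
  deg : (Fin n → ℕ) → Fin n → ℕ
  deg g u = ∑[ v < n ] (g v * 𝟙 (adj G u v))

  e : (Fin n → ℕ) → (Fin n → ℕ) → ℕ
  e f g = ∑[ u < n ] (f u * deg g u)

  e≡∑∑ : ∀ f g → e f g ≡ ∑[ u < n ] ∑[ v < n ] (f u * (g v * 𝟙 (adj G u v)))
  e≡∑∑ f g = sum-cong-≗ {n} (λ u → *-distribˡ-sum {n} (f u) _)

  e-comm : ∀ f g → e f g ≡ e g f
  e-comm f g = begin
    e f g                                                ≡⟨ e≡∑∑ f g ⟩
    ∑[ u < n ] ∑[ v < n ] (f u * (g v * 𝟙 (adj G u v))) ≡⟨ ∑-comm {n} {n} _ ⟩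
    ∑[ v < n ] ∑[ u < n ] (f u * (g v * 𝟙 (adj G u v))) ≡⟨ sum-cong-≗ {n} (λ v → sum-cong-≗ {n} (λ u → swap u v)) ⟩
    ∑[ v < n ] ∑[ u < n ] (g v * (f u * 𝟙 (adj G v u))) ≡⟨ sym (e≡∑∑ g f) ⟩
    e g f                                                ∎
    where
    open ≡-Reasoning
    swap : ∀ u v → f u * (g v * 𝟙 (adj G u v)) ≡ g v * (f u * 𝟙 (adj G v u))
    swap u v rewrite Graph.sym G u v = x∙yz≈y∙xz (f u) (g v) _

  e-congˡ : ∀ {f f′} g → (∀ u → f u ≡ f′ u) → e f g ≡ e f′ g
  e-congˡ g f≗f′ = sum-cong-≗ {n} (λ u → cong (_* deg g u) (f≗f′ u))

  e-congʳ : ∀ f {g g′} → (∀ u → g u ≡ g′ u) → e f g ≡ e f g′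
  e-congʳ f {g} {g′} g≗g′ = trans (e-comm f g) (trans (e-congˡ f g≗g′) (e-comm g′ f))

  e-distribˡ : ∀ f g h → e (λ u → f u + g u) h ≡ e f h + e g h
  e-distribˡ f g h = trans (sum-cong-≗ {n} (λ u → *-distribʳ-+ (deg h u) (f u) (g u))) (∑-distrib-+ {n} _ _)

  e-distribʳ : ∀ f g h → e f (λ u → g u + h u) ≡ e f g + e f h
  e-distribʳ f g h = begin
    e f (λ u → g u + h u) ≡⟨ e-comm f (λ u → g u + h u) ⟩
    e (λ u → g u + h u) f ≡⟨ e-distribˡ g h f ⟩
    e g f + e h f         ≡⟨ cong₂ _+_ (e-comm g f) (e-comm h f) ⟩
    e f g + e f h         ∎
    where open ≡-Reasoning

  e-monoʳ-≤ : ∀ f {g g′} → (∀ u → g u ≤ g′ u) → e f g ≤ e f g′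
  e-monoʳ-≤ f g≤g′ = ∑-mono-≤ (λ u → *-monoʳ-≤ (f u) (∑-mono-≤ (λ v → *-monoˡ-≤ _ (g≤g′ v))))

  e-splitˡ : ∀ p g → e (const 1) g ≡ e (χ p) g + e (χ (∁ p)) g
  e-splitˡ p g = trans (e-congˡ g (sym ∘ χ+χ∁≡1 p)) (e-distribˡ (χ p) (χ (∁ p)) g)

  e-splitʳ : ∀ p f → e f (const 1) ≡ e f (χ p) + e f (χ (∁ p))
  e-splitʳ p f = trans (e-congʳ f (sym ∘ χ+χ∁≡1 p)) (e-distribʳ f (χ p) (χ (∁ p)))

  e[f,g]≤∑f*k : ∀ f g {k} → (∀ u → deg g u ≤ k) → e f g ≤ (∑[ u < n ] f u) * k
  e[f,g]≤∑f*k f g {k} deg≤k = begin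
    e f g                    ≤⟨ ∑-mono-≤ (λ u → *-monoʳ-≤ (f u) (deg≤k u)) ⟩
    ∑[ u < n ] (f u * k)     ≡⟨ sym (*-distribʳ-sum {n} k f) ⟩
    (∑[ u < n ] f u) * k     ∎
    where open ≤-Reasoning

  2*edgeCount≤e[1,1] : 2 * edgeCount G ≤ e (const 1) (const 1)
  2*edgeCount≤e[1,1] = begin
    2 * edgeCount G                              ≡⟨ cong (edgeCount G +_) (+-identityʳ _) ⟩
    edgeCount G + edgeCount G                    ≡⟨ cong₂ _+_ edgeCount≡∑∑ (trans edgeCount≡∑∑ (∑-comm {n} {n} _)) ⟩
    (∑[ u < n ] ∑[ v < n ] before u v) + (∑[ u < n ] ∑[ v < n ] before v u)
                                                 ≡⟨ sym (∑∑-distrib-+ {n} _ _) ⟩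
    ∑[ u < n ] ∑[ v < n ] (before u v + before v u) ≤⟨ ∑-mono-≤ (λ u → ∑-mono-≤ (oriented u)) ⟩
    ∑[ u < n ] ∑[ v < n ] 𝟙 (adj G u v)          ≡⟨ sum-cong-≗ {n} (λ u → sym (all-ones u)) ⟩
    e (const 1) (const 1)                        ∎
    where
    open ≤-Reasoning
    before : Fin n → Fin n → ℕ
    before u v = 𝟙 ((toℕ u <ᵇ toℕ v) ∧ adj G u v)
    edgeCount≡∑∑ : edgeCount G ≡ ∑[ u < n ] ∑[ v < n ] before u v
    edgeCount≡∑∑ = trans (sum-map-tabulate {n = n} _ (λ u → u))
                         (sum-cong-≗ {n} (λ u → sum-map-tabulate {n = n} _ (λ v → v)))
    oriented : ∀ u v → before u v + before v u ≤ 𝟙 (adj G u v)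
    oriented u v rewrite Graph.sym G v u =
      𝟙-∧-exclusive (toℕ u <ᵇ toℕ v) (toℕ v <ᵇ toℕ u) (adj G u v)
                    (λ u<v v<u → <-asym (<ᵇ⇒< (toℕ u) (toℕ v) u<v) (<ᵇ⇒< (toℕ v) (toℕ u) v<u))
    all-ones : ∀ u → 1 * deg (const 1) u ≡ ∑[ v < n ] 𝟙 (adj G u v)
    all-ones u = trans (*-identityˡ _) (sum-cong-≗ {n} (λ v → *-identityˡ _))

  N : Fin n → Subset n
  N u = tabulate (adj G u)

  ∈N⇒Adj : ∀ {u v} → v ∈ N u → Adj G u v
  ∈N⇒Adj {u} {v} v∈Nu = trans (sym (lookup∘tabulate (adj G u) v)) ([]=⇒lookup v∈Nu)

  deg-χ≡∣∩N∣ : ∀ p u → deg (χ p) u ≡ ∣ p ∩ N u ∣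
  deg-χ≡∣∩N∣ p u = sym (trans (∣p∣≡∑χ (p ∩ N u)) (sum-cong-≗ {n} χ-∩N))
    where
    χ-∩N : ∀ v → χ (p ∩ N u) v ≡ χ p v * 𝟙 (adj G u v)
    χ-∩N v = trans (χ-∩ p (N u) v) (cong (λ b → χ p v * 𝟙 b) (lookup∘tabulate (adj G u) v))

  K4Free⇒TriangleFreeOn-N : K4Free G → ∀ p u → TriangleFreeOn G (p ∩ N u)
  K4Free⇒TriangleFreeOn-N k4 p u a b c a∈ b∈ c∈ = k4 u a b c (adjacent a∈) (adjacent b∈) (adjacent c∈)
    where
    adjacent : ∀ {x} → x ∈ p ∩ N u → Adj G u x
    adjacent x∈ = ∈N⇒Adj (p∩q⊆q p (N u) x∈)

  deg-χ≤max-triangle-free : K4Free G → ∀ {S k} → (∀ W → W ⊆ S → TriangleFreeOn G W → ∣ W ∣ ≤ k) →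
                            ∀ u → deg (χ S) u ≤ k
  deg-χ≤max-triangle-free k4 {S} max u =
    subst (_≤ _) (sym (deg-χ≡∣∩N∣ S u)) (max (S ∩ N u) (p∩q⊆p S (N u)) (K4Free⇒TriangleFreeOn-N k4 S u))

  Independent⇒e[χI,χI]≡0 : ∀ {I} → Independent G I → e (χ I) (χ I) ≡ 0
  Independent⇒e[χI,χI]≡0 {I} indep = begin
    e (χ I) (χ I)              ≡⟨ e≡∑∑ (χ I) (χ I) ⟩
    ∑[ u < n ] ∑[ v < n ] (χ I u * (χ I v * 𝟙 (adj G u v)))
                               ≡⟨ sum-cong-≗ {n} (λ u → sum-cong-≗ {n} (no-edge u)) ⟩
    ∑[ u < n ] ∑[ v < n ] 0    ≡⟨ trans (sum-cong-≗ {n} (λ _ → sum-replicate-zero n)) (sum-replicate-zero n) ⟩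
    0                          ∎
    where
    open ≡-Reasoning
    no-edge : ∀ u v → χ I u * (χ I v * 𝟙 (adj G u v)) ≡ 0
    no-edge u v = 𝟙*𝟙*𝟙≡0 (lookup I u) (lookup I v) (adj G u v)
                    (λ u∈ v∈ → indep u v (lookup⇒[]= u I u∈) (lookup⇒[]= v I v∈))

  2*e[f,g]≤e[f,f] : ∀ f g → (∀ u → g u ≤ f u) → e g g ≡ 0 → 2 * e f g ≤ e f f
  2*e[f,g]≤e[f,f] f g g≤f egg≡0 = begin
    2 * e f g             ≡⟨ cong (e f g +_) (+-identityʳ _) ⟩
    e f g + e f g         ≤⟨ +-monoʳ-≤ (e f g) efg≤erf ⟩
    e f g + e r f         ≡⟨ cong (_+ e r f) (e-comm f g) ⟩
    e g f + e r f         ≡⟨ sym (e-distribˡ g r f) ⟩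
    e (λ u → g u + r u) f ≡⟨ sym (e-congˡ f f≡g+r) ⟩
    e f f                 ∎
    where
    open ≤-Reasoning
    r : Fin n → ℕ
    r u = f u ∸ g u
    f≡g+r : ∀ u → f u ≡ g u + r u
    f≡g+r u = sym (m+[n∸m]≡n (g≤f u))
    efg≤erf : e f g ≤ e r f
    efg≤erf = begin
      e f g                 ≡⟨ e-congˡ g f≡g+r ⟩
      e (λ u → g u + r u) g ≡⟨ e-distribˡ g r g ⟩
      e g g + e r g         ≡⟨ cong (_+ e r g) egg≡0 ⟩
      e r g                 ≤⟨ e-monoʳ-≤ r g≤f ⟩
      e r f                 ∎

  TriangleFreeOn⇒deg+deg≤∣Z∣ : ∀ {Z u v} → TriangleFreeOn G Z → u ∈ Z → v ∈ Z → Adj G u v →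
                               deg (χ Z) u + deg (χ Z) v ≤ ∣ Z ∣
  TriangleFreeOn⇒deg+deg≤∣Z∣ {Z} {u} {v} tri u∈ v∈ uv = begin
    deg (χ Z) u + deg (χ Z) v                                    ≡⟨ sym (∑-distrib-+ {n} _ _) ⟩
    ∑[ w < n ] (χ Z w * 𝟙 (adj G u w) + χ Z w * 𝟙 (adj G v w)) ≤⟨ ∑-mono-≤ pointwise ⟩
    ∑[ w < n ] χ Z w                                             ≡⟨ sym (∣p∣≡∑χ Z) ⟩
    ∣ Z ∣                                                        ∎
    where
    open ≤-Reasoning
    pointwise : ∀ w → χ Z w * 𝟙 (adj G u w) + χ Z w * 𝟙 (adj G v w) ≤ χ Z w
    pointwise w = 𝟙*𝟙+𝟙*𝟙≤𝟙 (lookup Z w) (adj G u w) (adj G v w)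
                    (λ w∈ uw vw → tri u v w u∈ v∈ (lookup⇒[]= w Z w∈) uv uw vw)

  -- Adjacent u, v ∈ Z have no common neighbour in Z, so d u + d v ≤ ∣Z∣; summing over the
  -- edges of Z bounds Σ d², and Cauchy–Schwarz bounds (Σ d)² = A² by ∣Z∣ Σ d².
  mantel : ∀ {Z} → TriangleFreeOn G Z → 2 * e (χ Z) (χ Z) ≤ ∣ Z ∣ * ∣ Z ∣
  mantel {Z} tri = c*a*a≤b*a⇒c*a≤b 2 A (z * z) (begin
    2 * A * A     ≡⟨ *-assoc 2 A A ⟩
    2 * (A * A)   ≤⟨ *-monoʳ-≤ 2 cauchy-schwarz ⟩
    2 * (z * Q)   ≡⟨ x∙yz≈y∙xz 2 z Q ⟩
    z * (2 * Q)   ≤⟨ *-monoʳ-≤ z edge-sum ⟩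
    z * (A * z)   ≡⟨ reorder z A ⟩
    z * z * A     ∎)
    where
    open ≤-Reasoning
    ζ d ζd : Fin n → ℕ
    ζ = χ Z
    d = deg ζ
    ζd u = ζ u * d u
    z A Q : ℕ
    z = ∣ Z ∣
    A = e ζ ζ
    Q = e ζd ζ
    reorder : ∀ z a → z * (a * z) ≡ z * z * a
    reorder = solve-∀

    cauchy-schwarz : A * A ≤ z * Q
    cauchy-schwarz = subst (λ t → A * A ≤ t * Q) (sym (∣p∣≡∑χ Z)) (∑-cauchy-schwarz ζ d)

    edge-sum : 2 * Q ≤ A * z
    edge-sum = begin
      2 * Q                 ≡⟨ cong (Q +_) (trans (+-identityʳ Q) (e-comm ζd ζ)) ⟩
      Q + e ζ ζd            ≡⟨ cong₂ _+_ (e≡∑∑ ζd ζ) (e≡∑∑ ζ ζd) ⟩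
      (∑[ u < n ] ∑[ v < n ] (ζd u * (ζ v * a u v))) + (∑[ u < n ] ∑[ v < n ] (ζ u * (ζd v * a u v)))
                            ≡⟨ sym (∑∑-distrib-+ {n} _ _) ⟩
      ∑[ u < n ] ∑[ v < n ] (ζd u * (ζ v * a u v) + ζ u * (ζd v * a u v))
                            ≡⟨ sum-cong-≗ {n} (λ u → sum-cong-≗ {n} (λ v → regroup (ζ u) (ζ v) (a u v) (d u) (d v))) ⟩
      ∑[ u < n ] ∑[ v < n ] (ζ u * (ζ v * a u v) * (d u + d v))
                            ≤⟨ ∑-mono-≤ (λ u → ∑-mono-≤ (λ v → endpoints u v)) ⟩
      ∑[ u < n ] ∑[ v < n ] (ζ u * (ζ v * a u v) * z)
                            ≡⟨ sym (trans (*-distribʳ-sum {n} z _) (sum-cong-≗ {n} (λ u → *-distribʳ-sum {n} z _))) ⟩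
      (∑[ u < n ] ∑[ v < n ] (ζ u * (ζ v * a u v))) * z
                            ≡⟨ cong (_* z) (sym (e≡∑∑ ζ ζ)) ⟩
      A * z                 ∎
      where
      a : Fin n → Fin n → ℕ
      a u v = 𝟙 (adj G u v)
      regroup : ∀ p q x s t → p * s * (q * x) + p * (q * t * x) ≡ p * (q * x) * (s + t)
      regroup = solve-∀
      endpoints : ∀ u v → ζ u * (ζ v * a u v) * (d u + d v) ≤ ζ u * (ζ v * a u v) * z
      endpoints u v = 𝟙*𝟙*𝟙-*-mono-≤ (lookup Z u) (lookup Z v) (adj G u v)
        (λ u∈ v∈ uv → TriangleFreeOn⇒deg+deg≤∣Z∣ tri (lookup⇒[]= u Z u∈) (lookup⇒[]= v Z v∈) uv)

  2*edgeCount≤k*[n+∣I∣] : ∀ {I k} → Independent G I → (∀ u → deg (χ (∁ I)) u ≤ k) →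
                          2 * edgeCount G ≤ k * (n + ∣ I ∣)
  2*edgeCount≤k*[n+∣I∣] {I} {k} indep deg≤k = begin
    2 * edgeCount G                       ≤⟨ 2*edgeCount≤e[1,1] ⟩
    e 𝟏 𝟏                                 ≡⟨ e-splitʳ I 𝟏 ⟩
    e 𝟏 ι + e 𝟏 κ                         ≡⟨ cong (_+ e 𝟏 κ) e𝟏ι≡eικ ⟩
    e ι κ + e 𝟏 κ                         ≤⟨ +-mono-≤ (e[f,g]≤∑f*k ι κ deg≤k) (e[f,g]≤∑f*k 𝟏 κ deg≤k) ⟩
    (∑[ u < n ] ι u) * k + (∑[ u < n ] 1) * k
                                          ≡⟨ cong₂ (λ a b → a * k + b * k) (sym (∣p∣≡∑χ I)) (trans (∑-const n 1) (*-identityʳ n)) ⟩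
    ∣ I ∣ * k + n * k                     ≡⟨ collect ∣ I ∣ n k ⟩
    k * (n + ∣ I ∣)                       ∎
    where
    open ≤-Reasoning
    𝟏 ι κ : Fin n → ℕ
    𝟏 = const 1
    ι = χ I
    κ = χ (∁ I)
    e𝟏ι≡eικ : e 𝟏 ι ≡ e ι κ
    e𝟏ι≡eικ = trans (e-comm 𝟏 ι) (trans (e-splitʳ I ι) (cong (_+ e ι κ) (Independent⇒e[χI,χI]≡0 indep)))
    collect : ∀ i n k → i * k + n * k ≡ k * (n + i)
    collect = solve-∀

  2*e[χS,1]≤e[χS,χS]+2*∣S∣*k : ∀ {I S k} → Independent G I → I ⊆ S → (∀ u → deg (χ (∁ I)) u ≤ k) →
                                2 * e (χ S) (const 1) ≤ e (χ S) (χ S) + 2 * (∣ S ∣ * k)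
  2*e[χS,1]≤e[χS,χS]+2*∣S∣*k {I} {S} {k} indep I⊆S deg≤k = begin
    2 * e σ (const 1)                  ≡⟨ cong (2 *_) (e-splitʳ I σ) ⟩
    2 * (e σ ι + e σ κ)                ≡⟨ *-distribˡ-+ 2 (e σ ι) (e σ κ) ⟩
    2 * e σ ι + 2 * e σ κ              ≤⟨ +-mono-≤ (2*e[f,g]≤e[f,f] σ ι (χ-mono I⊆S) (Independent⇒e[χI,χI]≡0 indep))
                                                   (*-monoʳ-≤ 2 (e[f,g]≤∑f*k σ κ deg≤k)) ⟩
    e σ σ + 2 * ((∑[ u < n ] σ u) * k) ≡⟨ cong (λ t → e σ σ + 2 * (t * k)) (sym (∣p∣≡∑χ S)) ⟩
    e σ σ + 2 * (∣ S ∣ * k)            ∎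
    where
    open ≤-Reasoning
    σ ι κ : Fin n → ℕ
    σ = χ S
    ι = χ I
    κ = χ (∁ I)

  4*edgeCount+3*∣Z∣*∣Z∣≤4*∣Z∣*n : ∀ {I Z} → Independent G I → Z ⊆ ∁ I → TriangleFreeOn G Z →
                                  (∀ u → deg (χ (∁ I)) u ≤ ∣ Z ∣) →
                                  4 * edgeCount G + 3 * (∣ Z ∣ * ∣ Z ∣) ≤ 4 * (∣ Z ∣ * n)
  4*edgeCount+3*∣Z∣*∣Z∣≤4*∣Z∣*n {I} {Z} indep Z⊆∁I tri deg≤z = begin
    4 * edgeCount G + 3 * (z * z)           ≡⟨ cong (_+ 3 * (z * z)) (*-assoc 2 2 (edgeCount G)) ⟩
    2 * (2 * edgeCount G) + 3 * (z * z)     ≤⟨ +-monoˡ-≤ _ (*-monoʳ-≤ 2 split) ⟩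
    2 * (A + (2 * B + C)) + 3 * (z * z)     ≡⟨ cong (_+ 3 * (z * z)) (*-distribˡ-+ 2 A _) ⟩
    2 * A + 2 * (2 * B + C) + 3 * (z * z)   ≤⟨ +-monoˡ-≤ _ (+-mono-≤ (mantel tri) (*-monoʳ-≤ 2 outside)) ⟩
    z * z + 2 * (2 * (c * z)) + 3 * (z * z) ≡⟨ collect z c ⟩
    4 * (z * (z + c))                       ≡⟨ cong (λ m → 4 * (z * m)) (∣p∣+∣∁p∣≡n Z) ⟩
    4 * (z * n)                             ∎
    where
    open ≤-Reasoning
    𝟏 ζ o : Fin n → ℕ
    𝟏 = const 1
    ζ = χ Z
    o = χ (∁ Z)
    z c A B C : ℕ
    z = ∣ Z ∣
    c = ∣ ∁ Z ∣
    A = e ζ ζ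
    B = e o ζ
    C = e o o

    I⊆∁Z : I ⊆ ∁ Z
    I⊆∁Z x∈I = x∉p⇒x∈∁p (λ x∈Z → x∈∁p⇒x∉p (Z⊆∁I x∈Z) x∈I)

    split : 2 * edgeCount G ≤ A + (2 * B + C)
    split = begin
      2 * edgeCount G       ≤⟨ 2*edgeCount≤e[1,1] ⟩
      e 𝟏 𝟏                 ≡⟨ e-splitˡ Z 𝟏 ⟩
      e ζ 𝟏 + e o 𝟏         ≡⟨ cong₂ _+_ (e-splitʳ Z ζ) (e-splitʳ Z o) ⟩
      (A + e ζ o) + (B + C) ≡⟨ cong (λ t → (A + t) + (B + C)) (e-comm ζ o) ⟩
      (A + B) + (B + C)     ≡⟨ regroup A B C ⟩
      A + (2 * B + C)       ∎
      where
      regroup : ∀ a b c → (a + b) + (b + c) ≡ a + (2 * b + c)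
      regroup = solve-∀

    outside : 2 * B + C ≤ 2 * (c * z)
    outside = +-cancelʳ-≤ C _ _ (begin
      2 * B + C + C   ≡⟨ double B C ⟩
      2 * (B + C)     ≡⟨ cong (2 *_) (sym (e-splitʳ Z o)) ⟩
      2 * e o 𝟏       ≤⟨ 2*e[χS,1]≤e[χS,χS]+2*∣S∣*k indep I⊆∁Z deg≤z ⟩
      C + 2 * (c * z) ≡⟨ +-comm C _ ⟩
      2 * (c * z) + C ∎)
      where
      double : ∀ b c → 2 * b + c + c ≡ 2 * (b + c)
      double = solve-∀

    collect : ∀ z c → z * z + 2 * (2 * (c * z)) + 3 * (z * z) ≡ 4 * (z * (z + c))
    collect = solve-∀

lemma3p3 : (n : ℕ) (G : Graph n) → K4Free G →
    (I : Subset n) → Independent G I →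
    (Z : Subset n) → Z ⊆ ∁ I → TriangleFreeOn G Z →
    ((W : Subset n) → W ⊆ ∁ I → TriangleFreeOn G W → ∣ W ∣ ≤ ∣ Z ∣) →
    ((2 * edgeCount G ≤ ∣ Z ∣ * (n + ∣ I ∣))
      × (4 * edgeCount G + 3 * (∣ Z ∣ * ∣ Z ∣) ≤ 4 * (∣ Z ∣ * n)))
    × (n < 3 * ∣ I ∣ → 4 * edgeCount G ≤ (n ∸ ∣ I ∣) * (n + 3 * ∣ I ∣))
lemma3p3 n G k4 I indep Z Z⊆∁I tri max =
  (2*edgeCount≤k*[n+∣I∣] indep deg≤z , bound) ,
  λ n<3i → quadratic-bound-at z≤n∸i (m∸n+n≡m (∣p∣≤n I)) n<3i bound
  where
  open Counting G
  deg≤z : ∀ u → deg (χ (∁ I)) u ≤ ∣ Z ∣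
  deg≤z = deg-χ≤max-triangle-free k4 max
  bound : 4 * edgeCount G + 3 * (∣ Z ∣ * ∣ Z ∣) ≤ 4 * (∣ Z ∣ * n)
  bound = 4*edgeCount+3*∣Z∣*∣Z∣≤4*∣Z∣*n indep Z⊆∁I tri deg≤z
  z≤n∸i : ∣ Z ∣ ≤ n ∸ ∣ I ∣
  z≤n∸i = subst (∣ Z ∣ ≤_) (∣∁p∣≡n∸∣p∣ I) (p⊆q⇒∣p∣≤∣q∣ Z⊆∁I)
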